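{- Let $\mathbb{G}$ be the reflexive digraph on $\{0,1,2,3\}$ whose non-loop arcs are exactly $(0,1), (1,2),(2,1), (2,3),(3,0),(0,3)$. Then $\mathbb{G}$ is S\l upecki.
   Context: A $k$-ary polymorphism is a homomorphism $\mathbb{G}^k\to\mathbb{G}$ from the product digraph; it is essentially unary if it equals $(x_1,\dots,x_k)\mapsto g(x_i)$ for some $i$ and homomorphism $g:\mathbb{G}\to\mathbb{G}$. $\mathbb{G}$ is S\l upecki if for every $k\geq 2$ every surjective $k$-ary polymorphism is essentially unary. -}

module Defs where

open import Level using (Level; _⊔_; suc)
open import Data.Nat using (ℕ; _≥_)
open import Data.Fin using (Fin; zero; suc)
open import Data.Product using (Σ; ∃; _×_; _,_)
open import Relation.Binary.PropositionalEquality using (_≡_)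
open import Data.Empty using (⊥)
open import Data.Unit using (⊤)

record Digraph (a r : Level) : Set (Level.suc (a ⊔ r)) where
  field
    V : Set a
    E : V → V → Set r
open Digraph public

_^^_ : ∀ {a r} → Digraph a r → ℕ → Digraph a r
(G ^^ k) = record { V = Fin k → V G ; E = λ x y → ∀ i → E G (x i) (y i) }

IsHom : ∀ {a r b s} (G : Digraph a r) (H : Digraph b s) → (V G → V H) → Set (a ⊔ r ⊔ s)
IsHom G H f = ∀ {x y} → E G x y → E H (f x) (f y)

IsPolymorphism : ∀ {a r} (G : Digraph a r) (k : ℕ) → ((Fin k → V G) → V G) → Set (a ⊔ r)
IsPolymorphism G k f = IsHom (G ^^ k) G f

Surjective : ∀ {a b} {A : Set a} {B : Set b} → (A → B) → Set (a ⊔ b)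
Surjective {A = A} f = ∀ y → ∃ λ x → f x ≡ y

EssentiallyUnary : ∀ {a r} (G : Digraph a r) (k : ℕ) → ((Fin k → V G) → V G) → Set (a ⊔ r)
EssentiallyUnary G k f =
  Σ (Fin k) λ i → Σ (V G → V G) λ g → IsHom G G g × (∀ x → f x ≡ g (x i))

Slupecki : ∀ {a r} → Digraph a r → Set (a ⊔ r)
Slupecki G = ∀ (k : ℕ) → k ≥ 2 → (f : (Fin k → V G) → V G) →
  IsPolymorphism G k f → Surjective f → EssentiallyUnary G k f

GArc : Fin 4 → Fin 4 → Set
GArc zero zero = ⊤
GArc (suc zero) (suc zero) = ⊤
GArc (suc (suc zero)) (suc (suc zero)) = ⊤
GArc (suc (suc (suc zero))) (suc (suc (suc zero))) = ⊤
GArc zero (suc zero) = ⊤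
GArc (suc zero) (suc (suc zero)) = ⊤
GArc (suc (suc zero)) (suc zero) = ⊤
GArc (suc (suc zero)) (suc (suc (suc zero))) = ⊤
GArc (suc (suc (suc zero))) zero = ⊤
GArc zero (suc (suc (suc zero))) = ⊤
GArc _ _ = ⊥

𝔾 : Digraph Level.zero Level.zero
𝔾 = record { V = Fin 4 ; E = GArc }

-- Each vertex v of 𝔾 is determined by its block ({0,3} or {1,2}) and by whether it is an exit
-- (0 or 2): inside a block all arcs are present, and the only arcs between blocks run from an exit
-- to a non-exit. Tuples with equal blocks are adjacent in both directions, so the block of f x
-- depends only on the blocks of x, and by surjectivity not constantly; a hybrid argument finds a
-- coordinate i at which it changes. The exit structure then forces the block of f x to depend on
-- the block of x i alone. Finally, moving x i into the other block along an outgoing (incoming)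
-- arc changes the block of f x, so f x is an exit exactly when x i is; hence f x = f (x i, …, x i).
module Submission where

open import Data.Bool using (Bool; true; false; not)
open import Data.Bool.Properties using (_≟_; ¬-not; not-¬)
open import Data.Empty using (⊥-elim)
open import Data.Fin using (Fin; zero; suc) renaming (_≟_ to _≟ᶠ_)
open import Data.Nat using (ℕ; zero; suc)
open import Data.Product using (_×_; _,_; ∃; ∃₂; proj₁; proj₂)
import Data.Product as Product
open import Data.Sum using (_⊎_; inj₁; inj₂)
import Data.Sum as Sum
open import Data.Unit using (tt)
open import Data.Vec.Functional using (_∷_; tail; updateAt)
open import Data.Vec.Functional.Properties using (∷-cong; updateAt-updates; updateAt-minimal)
open import Function using (_∘_)
open import Level using (Level)
open import Relation.Binary.Definitions using (DecidableEquality)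
open import Relation.Binary.PropositionalEquality
open import Relation.Nullary using (yes; no; does)
open import Relation.Nullary.Decidable using (decidable-stable; dec-true)

open import Defs

module _ {a r : Level} (G : Digraph a r) (refl-G : ∀ v → E G v v) {k : ℕ} where

  updateAt-arcʳ : ∀ (x : Fin k → V G) i {v} → E G (x i) v → E (G ^^ k) x (updateAt x i (λ _ → v))
  updateAt-arcʳ x i {v} xᵢ→v j with j ≟ᶠ i
  ... | yes refl = subst (E G (x i)) (sym (updateAt-updates i x)) xᵢ→v
  ... | no j≢i   = subst (E G (x j)) (sym (updateAt-minimal j i x j≢i)) (refl-G (x j))

  updateAt-arcˡ : ∀ (x : Fin k → V G) i {v} → E G v (x i) → E (G ^^ k) (updateAt x i (λ _ → v)) x
  updateAt-arcˡ x i {v} v→xᵢ j with j ≟ᶠ i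
  ... | yes refl = subst (λ w → E G w (x i)) (sym (updateAt-updates i x)) v→xᵢ
  ... | no j≢i   = subst (λ w → E G w (x j)) (sym (updateAt-minimal j i x j≢i)) (refl-G (x j))

-- The hybrid argument. Φ is assumed to respect pointwise equality, for lack of function extensionality.
change-in-one-coordinate :
  ∀ {a b} {A : Set a} {B : Set b} → DecidableEquality B →
  ∀ k (Φ : (Fin k → A) → B) → (∀ {x y} → x ≗ y → Φ x ≡ Φ y) →
  ∀ {u v} → Φ u ≢ Φ v →
  ∃ λ i → ∃₂ λ x y → (∀ j → j ≢ i → x j ≡ y j) × Φ x ≢ Φ y
change-in-one-coordinate _≟ᴮ_ zero    Φ Φ-cong Φu≢Φv = ⊥-elim (Φu≢Φv (Φ-cong λ ()))
change-in-one-coordinate _≟ᴮ_ (suc k) Φ Φ-cong {u} {v} Φu≢Φv with Φ u ≟ᴮ Φ (v zero ∷ tail u)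
... | no Φu≢Φw = zero , u , v zero ∷ tail u , agree-off-zero , Φu≢Φw
  where
  agree-off-zero : ∀ j → j ≢ zero → u j ≡ (v zero ∷ tail u) j
  agree-off-zero zero    0≢0 = ⊥-elim (0≢0 refl)
  agree-off-zero (suc j) _   = refl
... | yes Φu≡Φw
  with i , x , y , agree , Φx≢Φy ←
    change-in-one-coordinate _≟ᴮ_ k (Φ ∘ (v zero ∷_)) (Φ-cong ∘ ∷-cong refl)
      (λ eq → Φu≢Φv (trans Φu≡Φw (trans eq (Φ-cong (∷-cong refl λ _ → refl)))))
  = suc i , v zero ∷ x , v zero ∷ y , agree-off-suc , Φx≢Φy
  where
  agree-off-suc : ∀ j → j ≢ suc i → (v zero ∷ x) j ≡ (v zero ∷ y) j
  agree-off-suc zero    _     = refl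
  agree-off-suc (suc j) j≢1+i = agree j (j≢1+i ∘ cong suc)

pattern v₀ = zero
pattern v₁ = suc zero
pattern v₂ = suc (suc zero)
pattern v₃ = suc (suc (suc zero))

block : Fin 4 → Bool
block v₀ = false
block v₁ = true
block v₂ = true
block v₃ = false

exit : Fin 4 → Bool
exit v₀ = true
exit v₁ = false
exit v₂ = true
exit v₃ = false

vertex : Bool → Bool → Fin 4
vertex false true  = v₀
vertex true  false = v₁
vertex true  true  = v₂
vertex false false = v₃

block-vertex : ∀ b e → block (vertex b e) ≡ b
block-vertex false true  = refl
block-vertex true  false = refl
block-vertex true  true  = refl
block-vertex false false = refl

exit-vertex : ∀ b e → exit (vertex b e) ≡ e
exit-vertex false true  = refl
exit-vertex true  false = refl
exit-vertex true  true  = refl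
exit-vertex false false = refl

block-vertex-not : ∀ b e → b ≢ block (vertex (not b) e)
block-vertex-not b e eq = not-¬ refl (trans eq (block-vertex (not b) e))

vertex-block-exit : ∀ v → vertex (block v) (exit v) ≡ v
vertex-block-exit v₀ = refl
vertex-block-exit v₁ = refl
vertex-block-exit v₂ = refl
vertex-block-exit v₃ = refl

block-exit-injective : ∀ {u v} → block u ≡ block v → exit u ≡ exit v → u ≡ v
block-exit-injective {u} {v} b≡b′ e≡e′ = begin
  u                           ≡⟨ vertex-block-exit u ⟨
  vertex (block u) (exit u)   ≡⟨ cong₂ vertex b≡b′ e≡e′ ⟩
  vertex (block v) (exit v)   ≡⟨ vertex-block-exit v ⟩
  v                           ∎
  where open ≡-Reasoning

ArcProfile : (b e b′ e′ : Bool) → Set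
ArcProfile b e b′ e′ = b ≡ b′ ⊎ (e ≡ true × e′ ≡ false)

_⇝_ : Fin 4 → Fin 4 → Set
u ⇝ v = ArcProfile (block u) (exit u) (block v) (exit v)

arc⇒⇝ : ∀ {u v} → GArc u v → u ⇝ v
arc⇒⇝ {v₀} {v₀} _ = inj₁ refl
arc⇒⇝ {v₀} {v₁} _ = inj₂ (refl , refl)
arc⇒⇝ {v₀} {v₂} ()
arc⇒⇝ {v₀} {v₃} _ = inj₁ refl
arc⇒⇝ {v₁} {v₀} ()
arc⇒⇝ {v₁} {v₁} _ = inj₁ refl
arc⇒⇝ {v₁} {v₂} _ = inj₁ refl
arc⇒⇝ {v₁} {v₃} ()
arc⇒⇝ {v₂} {v₀} ()
arc⇒⇝ {v₂} {v₁} _ = inj₁ refl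
arc⇒⇝ {v₂} {v₂} _ = inj₁ refl
arc⇒⇝ {v₂} {v₃} _ = inj₂ (refl , refl)
arc⇒⇝ {v₃} {v₀} _ = inj₁ refl
arc⇒⇝ {v₃} {v₁} ()
arc⇒⇝ {v₃} {v₂} ()
arc⇒⇝ {v₃} {v₃} _ = inj₁ refl

⇝⇒arc : ∀ {u v} → u ⇝ v → GArc u v
⇝⇒arc {v₀} {v₂} (inj₂ (_ , ()))
⇝⇒arc {v₁} {v₀} (inj₂ (() , _))
⇝⇒arc {v₁} {v₃} (inj₂ (() , _))
⇝⇒arc {v₂} {v₀} (inj₂ (_ , ()))
⇝⇒arc {v₃} {v₁} (inj₂ (() , _))
⇝⇒arc {v₃} {v₂} (inj₂ (() , _))
⇝⇒arc {v₀} {v₀} _ = tt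
⇝⇒arc {v₀} {v₁} _ = tt
⇝⇒arc {v₀} {v₃} _ = tt
⇝⇒arc {v₁} {v₁} _ = tt
⇝⇒arc {v₁} {v₂} _ = tt
⇝⇒arc {v₂} {v₁} _ = tt
⇝⇒arc {v₂} {v₂} _ = tt
⇝⇒arc {v₂} {v₃} _ = tt
⇝⇒arc {v₃} {v₀} _ = tt
⇝⇒arc {v₃} {v₃} _ = tt

arc-refl : ∀ v → GArc v v
arc-refl v = ⇝⇒arc (inj₁ refl)

vertex-arc : ∀ {b e b′ e′} → ArcProfile b e b′ e′ → GArc (vertex b e) (vertex b′ e′)
vertex-arc {b} {e} {b′} {e′} = ⇝⇒arc ∘ Sum.map
  (λ b≡b′ → trans (block-vertex b e) (trans b≡b′ (sym (block-vertex b′ e′))))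
  (Product.map (trans (exit-vertex b e)) (trans (exit-vertex b′ e′)))

two-way-arc⇒same-block : ∀ {u v} → GArc u v → GArc v u → block u ≡ block v
two-way-arc⇒same-block u→v v→u with arc⇒⇝ u→v | arc⇒⇝ v→u
... | inj₁ same         | _                  = same
... | _                 | inj₁ same          = sym same
... | inj₂ (exitᵤ , _)  | inj₂ (_ , ¬exitᵤ)  = ⊥-elim (not-¬ refl (trans (sym exitᵤ) ¬exitᵤ))

module Polymorphism {k : ℕ} (f : (Fin k → Fin 4) → Fin 4) (f-pol : IsPolymorphism 𝔾 k f) where

  fBlock : (Fin k → Fin 4) → Bool
  fBlock x = block (f x)

  fBlock-cong : ∀ {x y} → (∀ j → block (x j) ≡ block (y j)) → fBlock x ≡ fBlock y
  fBlock-cong x≈y = two-way-arc⇒same-block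
    (f-pol λ j → ⇝⇒arc (inj₁ (x≈y j)))
    (f-pol λ j → ⇝⇒arc (inj₁ (sym (x≈y j))))

  surjective⇒fBlock-changes : Surjective f → ∃₂ λ u w → fBlock u ≢ fBlock w
  surjective⇒fBlock-changes f-surj with u , fu≡v₀ ← f-surj v₀ | w , fw≡v₁ ← f-surj v₁ =
    u , w , λ eq → not-¬ refl (trans (sym (cong block fu≡v₀)) (trans eq (cong block fw≡v₁)))

  exit-on-block-change : ∀ {x y} → (∀ j → GArc (x j) (y j)) → fBlock x ≢ fBlock y →
                         exit (f x) ≡ true × exit (f y) ≡ false
  exit-on-block-change x→y changes with arc⇒⇝ (f-pol x→y)
  ... | inj₁ same  = ⊥-elim (changes same)
  ... | inj₂ exits = exits

  -- Were fBlock x ≢ fBlock P, then f z would have to be an exit vertex (because of the arc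
  -- z → y₁, which changes fBlock) and a non-exit vertex (because of the arc y₂ → z).
  fBlock-on-side : ∀ i {P P′} → (∀ j → j ≢ i → block (P j) ≡ block (P′ j)) → fBlock P ≢ fBlock P′ →
                   ∀ x → block (x i) ≡ block (P i) → fBlock x ≡ fBlock P
  fBlock-on-side i {P} {P′} agree changes x xᵢ≡Pᵢ = decidable-stable (fBlock x ≟ fBlock P) λ x≢P →
    not-¬ refl (trans (sym (proj₁ (exit-on-block-change z→y₁ z≢y₁)))
                      (proj₂ (exit-on-block-change y₂→z (y₂≢z x≢P))))
    where
    z y₁ y₂ : Fin k → Fin 4
    z  j = vertex (block (P j)) (does (block (x j) ≟ block (P j)))
    y₁ j = vertex (block (P′ j)) false
    y₂ j = vertex (block (x j)) true

    z→y₁ : ∀ j → GArc (z j) (y₁ j)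
    z→y₁ j with j ≟ᶠ i
    ... | yes refl = vertex-arc (inj₂ (dec-true (block (x i) ≟ block (P i)) xᵢ≡Pᵢ , refl))
    ... | no j≢i   = vertex-arc (inj₁ (agree j j≢i))

    y₂→z : ∀ j → GArc (y₂ j) (z j)
    y₂→z j with block (x j) ≟ block (P j)
    ... | yes same = vertex-arc (inj₁ same)
    ... | no _     = vertex-arc (inj₂ (refl , refl))

    z≡P : fBlock z ≡ fBlock P
    z≡P = fBlock-cong λ j → block-vertex _ _
    y₁≡P′ : fBlock y₁ ≡ fBlock P′
    y₁≡P′ = fBlock-cong λ j → block-vertex _ _
    y₂≡x : fBlock y₂ ≡ fBlock x
    y₂≡x = fBlock-cong λ j → block-vertex _ _

    z≢y₁ : fBlock z ≢ fBlock y₁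
    z≢y₁ eq = changes (trans (sym z≡P) (trans eq y₁≡P′))
    y₂≢z : fBlock x ≢ fBlock P → fBlock y₂ ≢ fBlock z
    y₂≢z x≢P eq = x≢P (trans (sym y₂≡x) (trans eq z≡P))

  module Pivot (i : Fin k) {P P′ : Fin k → Fin 4}
               (agree : ∀ j → j ≢ i → block (P j) ≡ block (P′ j))
               (changes : fBlock P ≢ fBlock P′) where

    pivot-block-changes : block (P i) ≢ block (P′ i)
    pivot-block-changes Pᵢ≡P′ᵢ = changes (fBlock-cong agree-everywhere)
      where
      agree-everywhere : ∀ j → block (P j) ≡ block (P′ j)
      agree-everywhere j with j ≟ᶠ i
      ... | yes refl = Pᵢ≡P′ᵢ
      ... | no j≢i   = agree j j≢i

    on-P-side : ∀ x → block (x i) ≡ block (P i) → fBlock x ≡ fBlock P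
    on-P-side = fBlock-on-side i agree changes

    on-P′-side : ∀ x → block (x i) ≢ block (P i) → fBlock x ≡ fBlock P′
    on-P′-side x xᵢ≢Pᵢ = fBlock-on-side i (λ j → sym ∘ agree j) (changes ∘ sym) x
      (trans (¬-not xᵢ≢Pᵢ) (sym (¬-not (≢-sym pivot-block-changes))))

    fBlock-respects-pivot : ∀ x y → block (x i) ≡ block (y i) → fBlock x ≡ fBlock y
    fBlock-respects-pivot x y xᵢ≡yᵢ with block (x i) ≟ block (P i)
    ... | yes xᵢ≡Pᵢ = trans (on-P-side x xᵢ≡Pᵢ) (sym (on-P-side y (trans (sym xᵢ≡yᵢ) xᵢ≡Pᵢ)))
    ... | no xᵢ≢Pᵢ  = trans (on-P′-side x xᵢ≢Pᵢ) (sym (on-P′-side y (xᵢ≢Pᵢ ∘ trans xᵢ≡yᵢ)))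

    fBlock-reflects-pivot : ∀ x y → fBlock x ≡ fBlock y → block (x i) ≡ block (y i)
    fBlock-reflects-pivot x y x≡y with block (x i) ≟ block (P i) | block (y i) ≟ block (P i)
    ... | yes xᵢ≡Pᵢ | yes yᵢ≡Pᵢ = trans xᵢ≡Pᵢ (sym yᵢ≡Pᵢ)
    ... | yes xᵢ≡Pᵢ | no yᵢ≢Pᵢ  =
      ⊥-elim (changes (trans (sym (on-P-side x xᵢ≡Pᵢ)) (trans x≡y (on-P′-side y yᵢ≢Pᵢ))))
    ... | no xᵢ≢Pᵢ  | yes yᵢ≡Pᵢ =
      ⊥-elim (changes (trans (sym (on-P-side y yᵢ≡Pᵢ)) (trans (sym x≡y) (on-P′-side x xᵢ≢Pᵢ))))
    ... | no xᵢ≢Pᵢ  | no yᵢ≢Pᵢ  = trans (¬-not xᵢ≢Pᵢ) (sym (¬-not yᵢ≢Pᵢ))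

    fBlock-changes-at-pivot : ∀ x {v} → block (x i) ≢ block v → fBlock x ≢ fBlock (updateAt x i (λ _ → v))
    fBlock-changes-at-pivot x xᵢ≢v eq =
      xᵢ≢v (trans (fBlock-reflects-pivot x _ eq) (cong block (updateAt-updates i x)))

    exit-follows-pivot : ∀ x → exit (f x) ≡ exit (x i)
    exit-follows-pivot x with exit (x i) in exitᵢ
    ... | true  = proj₁ (exit-on-block-change
                          (updateAt-arcʳ 𝔾 arc-refl x i (⇝⇒arc (inj₂ (exitᵢ , exit-vertex _ false))))
                          (fBlock-changes-at-pivot x (block-vertex-not _ _)))
    ... | false = proj₂ (exit-on-block-change
                          (updateAt-arcˡ 𝔾 arc-refl x i (⇝⇒arc (inj₂ (exit-vertex _ true , exitᵢ))))
                          (≢-sym (fBlock-changes-at-pivot x (block-vertex-not _ _))))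

    f-factors-through-pivot : ∀ x → f x ≡ f (λ _ → x i)
    f-factors-through-pivot x = block-exit-injective
      (fBlock-respects-pivot x (λ _ → x i) refl)
      (trans (exit-follows-pivot x) (sym (exit-follows-pivot (λ _ → x i))))

proposition4p9 : Slupecki 𝔾
proposition4p9 k _ f f-pol f-surj =
  let open Polymorphism f f-pol
      u , w , u≢w = surjective⇒fBlock-changes f-surj
      i , P , P′ , agree , changes =
        change-in-one-coordinate _≟_ k fBlock (fBlock-cong ∘ (cong block ∘_)) u≢w
  in  i , (λ v → f (λ _ → v)) , (λ v→w → f-pol λ _ → v→w)
      , Pivot.f-factors-through-pivot i (λ j → cong block ∘ agree j) changes
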